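{- For integers $m,n\ge 1$, let $\mathcal{P}$ be a coarsening of the column set of $(m+2)P_n$ with $|\mathcal{P}|=k\ge 2$ and let $F$ be a symmetric subset of $\mathcal{P}^2$. Let $X$ and $X'$ be distinct sets in $\mathcal{P}$ such that $(X,X),(X',X')\in F$ and $(X,X')\notin F$. If the $(\mathcal{P},F)$-flip $G$ of $(m+2)P_n$ has a $\bigcup\mathcal{P}$-path from $X$ to $X'$, then $G$ has a pivot-minor isomorphic to a $(k-1)$-flipped $mP_n$.
   Context: Graphs are finite and simple. Local complementation: $G\ast x:=(V(G),E(G)\triangle\{yz:y,z\in N_G(x),y\neq z\})$; pivoting an edge $uv$: $G\wedge uv:=G\ast u\ast v\ast u$; a pivot-minor is obtained by a (possibly empty) sequence of vertex deletions and pivotings. $mP_n$ is the disjoint union of $m$ copies of $P_n$, with vertex set $[m]\times[n]$, $(i,j)$ being the $j$-th vertex of the $i$-th path; the $j$-th column is $\{(i,j):i\in[m]\}$; the column set is the set of all columns. A coarsening of a collection $\mathcal{P}$ of disjoint sets is a collection of pairwise disjoint non-empty sets each a union of members of $\mathcal{P}$. $\bigcup\mathcal{P}$ denotes the union of the members of $\mathcal{P}$. For a set $Z$ of vertices, a $Z$-path is a path between two vertices of $Z$ with no internal vertex in $Z$; a $\bigcup\mathcal{P}$-path from $X$ to $X'$ is such a path (with $Z=\bigcup\mathcal{P}$) starting in $X$ and ending in $X'$. $F\subseteq\mathcal{P}^2$ is symmetric if $(X,X')\in F\Rightarrow(X',X)\in F$. For a graph $H$ and a collection $\mathcal{P}$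 of pairwise disjoint non-empty subsets of $V(H)$, let $\mathcal{P}(v)$ be the member of $\mathcal{P}$ containing $v$ if any, else $\{v\}$. The $(\mathcal{P},F)$-flip of $H$ has vertex set $V(H)$ and distinct $u,v$ adjacent iff either $uv\notin E(H)$ and $(\mathcal{P}(u),\mathcal{P}(v))\in F$, or $uv\in E(H)$ and $(\mathcal{P}(u),\mathcal{P}(v))\notin F$. A $\mathcal{P}$-flip is a $(\mathcal{P},F)$-flip for some symmetric $F$. A $k$-flipped $mP_n$ is a $\mathcal{P}$-flip of $mP_n$ where $\mathcal{P}$ is a coarsening of the column set of $mP_n$ with $|\mathcal{P}|\le k$. -}

module Defs where

open import Data.Bool using (Bool; true; false; not; _∧_; _∨_; _xor_; T)
open import Data.Bool.Properties using (∧-comm; ∨-comm; ∧-zeroʳ)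
open import Data.Nat using (ℕ; zero; suc; _+_; _≤_; _<_; _≡ᵇ_)
open import Data.Fin using (Fin; toℕ; inject₁; fromℕ) renaming (zero to fzero; suc to fsuc)
import Data.Fin as Fin
open import Data.Maybe using (Maybe; just; nothing; is-just)
open import Data.Product using (Σ; ∃; _×_; _,_; proj₁; proj₂)
open import Data.Product.Properties using (≡-dec)
open import Data.Unit using (tt)
open import Data.Empty using (⊥-elim)
open import Function using (_∘_)
open import Function.Bundles using (_↔_; Inverse)
open import Relation.Nullary using (yes; no; does; ¬_)
open import Relation.Binary.Definitions using (DecidableEquality)
open import Relation.Binary.PropositionalEquality using (_≡_; _≢_; refl; sym; cong; cong₂)

-- All graphs we build are
-- on finite vertex types (Fin m × Fin n and subtypes of these).

record Graph : Set₁ where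
  field
    V          : Set
    _≟_        : DecidableEquality V
    adj        : V → V → Bool
    adj-sym    : ∀ u v → adj u v ≡ adj v u
    adj-irrefl : ∀ v → adj v v ≡ false

open Graph public

does-sym : {A : Set} (eq : DecidableEquality A) (x y : A) → does (eq x y) ≡ does (eq y x)
does-sym eq x y with eq x y | eq y x
... | yes _ | yes _ = refl
... | no _  | no _  = refl
... | yes p | no q  = ⊥-elim (q (sym p))
... | no p  | yes q = ⊥-elim (p (sym q))

does-refl : {A : Set} (eq : DecidableEquality A) (x : A) → does (eq x x) ≡ true
does-refl eq x with eq x x
... | yes _ = refl
... | no ne = ⊥-elim (ne refl)

T-irr : ∀ {b} (p q : T b) → p ≡ q
T-irr {true} _ _ = refl

toggle : (G : Graph) (t : V G → V G → Bool) → (∀ u v → t u v ≡ t v u) → Graph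
toggle G t tsym = record
  { V = V G ; _≟_ = _≟_ G
  ; adj = λ u v → adj G u v xor (t u v ∧ not (does (_≟_ G u v)))
  ; adj-sym = λ u v → cong₂ _xor_ (adj-sym G u v)
                        (cong₂ _∧_ (tsym u v) (cong not (does-sym (_≟_ G) u v)))
  ; adj-irrefl = λ v → irr v }
  where
  irr : ∀ v → (adj G v v xor (t v v ∧ not (does (_≟_ G v v)))) ≡ false
  irr v rewrite does-refl (_≟_ G) v | ∧-zeroʳ (t v v) | adj-irrefl G v = refl

localComp : (G : Graph) → V G → Graph
localComp G x = toggle G (λ y z → adj G x y ∧ adj G x z)
                         (λ y z → ∧-comm (adj G x y) (adj G x z))

pivot : (G : Graph) → V G → V G → Graph
pivot G u v = localComp (localComp (localComp G u) v) u

delete : (G : Graph) → V G → Graph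
delete G v = record
  { V = Σ (V G) (λ w → T (not (does (_≟_ G w v))))
  ; _≟_ = deq
  ; adj = λ a b → adj G (proj₁ a) (proj₁ b)
  ; adj-sym = λ a b → adj-sym G (proj₁ a) (proj₁ b)
  ; adj-irrefl = λ a → adj-irrefl G (proj₁ a) }
  where
  deq : DecidableEquality (Σ (V G) (λ w → T (not (does (_≟_ G w v)))))
  deq (a , p) (b , q) with _≟_ G a b
  ... | yes refl = yes (cong (a ,_) (T-irr p q))
  ... | no ne = no (ne ∘ cong proj₁)

data PivotMinor (G : Graph) : Graph → Set₁ where
  pm-refl  : PivotMinor G G
  pm-del   : ∀ {H} → PivotMinor G H → (v : V H) → PivotMinor G (delete H v)
  pm-pivot : ∀ {H} → PivotMinor G H → (u v : V H) → adj H u v ≡ true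
           → PivotMinor G (pivot H u v)

record _≅_ (G H : Graph) : Set where
  field
    bij      : V G ↔ V H
    adj-pres : ∀ u v → adj H (Inverse.to bij u) (Inverse.to bij v) ≡ adj G u v

-- m P_n : vertex (i , j) is the j-th vertex of the i-th path (0-indexed)

suc≢ᵇ : ∀ j → (suc j ≡ᵇ j) ≡ false
suc≢ᵇ zero = refl
suc≢ᵇ (suc j) = suc≢ᵇ j

pathAdj : (m n : ℕ) → Fin m × Fin n → Fin m × Fin n → Bool
pathAdj m n (i , j) (i' , j') =
  does (i Fin.≟ i') ∧ ((suc (toℕ j) ≡ᵇ toℕ j') ∨ (suc (toℕ j') ≡ᵇ toℕ j))

mP : ℕ → ℕ → Graph
mP m n = record
  { V = Fin m × Fin n
  ; _≟_ = ≡-dec Fin._≟_ Fin._≟_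
  ; adj = pathAdj m n
  ; adj-sym = λ { (i , j) (i' , j') →
      cong₂ _∧_ (does-sym Fin._≟_ i i')
                (∨-comm (suc (toℕ j) ≡ᵇ toℕ j') (suc (toℕ j') ≡ᵇ toℕ j)) }
  ; adj-irrefl = irr }
  where
  irr : ∀ v → pathAdj m n v v ≡ false
  irr (i , j) rewrite does-refl Fin._≟_ i | suc≢ᵇ (toℕ j) = refl

-- A coarsening 𝒫 of the column set of mP_n with |𝒫| = k: the k members
-- are labelled by Fin k; column j belongs to member ℓ iff part j ≡ just ℓ,
-- and to no member iff part j ≡ nothing.
record Coarsening (n k : ℕ) : Set where
  field
    part     : Fin n → Maybe (Fin k)
    nonempty : ∀ (ℓ : Fin k) → ∃ λ j → part j ≡ just ℓ

open Coarsening public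

colPart : ∀ {m n k} → Coarsening n k → Fin m × Fin n → Maybe (Fin k)
colPart C (i , j) = part C j

-- (𝒫(u), 𝒫(v)) ∈ F ; false if u or v lies in no member of 𝒫
-- (then 𝒫(u) = {u} ∉ 𝒫, so the pair is not in F ⊆ 𝒫²)
inF : ∀ {k} → (Fin k → Fin k → Bool) → Maybe (Fin k) → Maybe (Fin k) → Bool
inF F (just a) (just b) = F a b
inF F _ _ = false

inF-sym : ∀ {k} (F : Fin k → Fin k → Bool) → (∀ a b → F a b ≡ F b a)
        → ∀ x y → inF F x y ≡ inF F y x
inF-sym F Fs (just a) (just b) = Fs a b
inF-sym F Fs (just a) nothing = refl
inF-sym F Fs nothing (just b) = refl
inF-sym F Fs nothing nothing = refl

flipMP : (m n k : ℕ) (C : Coarsening n k) (F : Fin k → Fin k → Bool)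
       → (∀ a b → F a b ≡ F b a) → Graph
flipMP m n k C F Fs =
  toggle (mP m n) (λ u v → inF F (colPart C u) (colPart C v))
         (λ u v → inF-sym F Fs (colPart C u) (colPart C v))

KFlippedIso : ℕ → ℕ → ℕ → Graph → Set
KFlippedIso k m n H =
  Σ ℕ λ k' → k' ≤ k × Σ (Coarsening n k') λ C →
  Σ (Fin k' → Fin k' → Bool) λ F → Σ (∀ a b → F a b ≡ F b a) λ Fs →
  H ≅ flipMP m n k' C F Fs

record ZPath (G : Graph) (Z A B : V G → Bool) : Set where
  field
    r        : ℕ
    p        : Fin (suc r) → V G
    injective : ∀ a b → p a ≡ p b → a ≡ b
    step     : ∀ (i : Fin r) → adj G (p (inject₁ i)) (p (fsuc i)) ≡ true
    start    : A (p fzero) ≡ true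
    end      : B (p (fromℕ r)) ≡ true
    internal : ∀ (i : Fin (suc r)) → 0 < toℕ i → toℕ i < r → Z (p i) ≡ false

inUnion : ∀ {m n k} → Coarsening n k → Fin m × Fin n → Bool
inUnion C v = is-just (colPart C v)

inMember : ∀ {m n k} → Coarsening n k → Fin k → Fin m × Fin n → Bool
inMember C ℓ v with colPart C v
... | just a  = does (a Fin.≟ ℓ)
... | nothing = false

-- Shorten the Z-path to an induced path y₀ … y_r inside one row: its interior avoids ⋃𝒫, so
-- every edge at an interior vertex is an unflipped path edge and interior vertices have degree 2.
-- Let t be the vertex of a second row in the column of y₀. Towards the remaining m rows t is a
-- twin of y₀, and on the path t sees y₀ only. Pivoting consecutive edges of the path (starting
-- with t y₀ when r is even) contracts it; on the remaining rows this complements the edges between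
-- N(y₀) and N(y_r), which is the flip by F + [X]⊗[X'] + [X']⊗[X]. Since F X X = F X' X' = 1 and
-- F X X' = 0, the parts X and X' are twins for this flip and can be merged, leaving k − 1 parts.

module Submission where

open import Defs
open import Data.Bool using (Bool; true; false; not; _∧_; _xor_; T)
open import Data.Bool.Properties
  using (∧-comm; ∧-identityʳ; ∧-zeroʳ; xor-comm; xor-identityʳ; xor-same; xor-assoc; T-≡)
open import Data.Bool.Solver using (module xor-∧-Solver)
open import Data.Empty using (⊥; ⊥-elim)
open import Data.Fin using (Fin; toℕ; fromℕ; fromℕ<; punchIn; punchOut; combine; remQuot)
  renaming (zero to fzero; suc to fsuc)
import Data.Fin as Fin
open import Data.Fin.Properties
  using (toℕ-injective; toℕ-fromℕ<; toℕ-fromℕ; toℕ-inject₁; punchIn-injective; punchInᵢ≢i;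
         punchIn-punchOut; punchOut-punchIn; punchOut-cong; remQuot-combine)
  renaming (suc-injective to fsuc-injective)
open import Data.Maybe using (Maybe; just; nothing; is-just; _>>=_)
import Data.Maybe as Maybe
open import Data.Maybe.Properties using (just-injective)
open import Data.Nat using (ℕ; zero; suc; _+_; _*_; _∸_; _≤_; _<_; _≡ᵇ_; z≤n; s≤s)
import Data.Nat as ℕ
open import Data.Nat.Properties
  using (≤-refl; ≤-trans; <⇒≤; <-≤-trans; <-trans; <-irrefl; ≤∧≢⇒<; n≤1+n; n<1+n; suc-injective;
         ≡ᵇ⇒≡; m⊓n≤n; m≤n⇒m⊓n≡m)
open import Data.Product using (Σ; ∃; _×_; _,_; proj₁; proj₂)
open import Data.Sum using (_⊎_; inj₁; inj₂)
open import Function using (_∘_; case_of_)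
open import Function.Bundles using (Equivalence; mk↔ₛ′; mk⇔)
open import Function.Properties.Inverse using (↔-refl; ↔-trans)
open import Relation.Nullary using (Dec; yes; no; does; ¬_)
open import Relation.Nullary.Decidable using (dec-false; does-⇔; map′; T?; dec⇒maybe)
open import Relation.Binary.PropositionalEquality

-- Local complementation and pivoting

cross : {W : Set} → (W → Bool) → (W → Bool) → W → W → Bool
cross f g y z = (f y ∧ g z) xor (g y ∧ f z)

module _ {W : Set} (f g : W → Bool) where

  cross-sym : ∀ y z → cross f g y z ≡ cross f g z y
  cross-sym y z rewrite ∧-comm (f y) (g z) | ∧-comm (g y) (f z) = xor-comm (g z ∧ f y) (f z ∧ g y)

  cross-diagonal : ∀ y → cross f g y y ≡ false
  cross-diagonal y rewrite ∧-comm (f y) (g y) = xor-same (g y ∧ f y)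

module _ (G : Graph) {u v y z : V G} where

  cross-zeroˡ : adj G u y ≡ false → adj G u z ≡ false → cross (adj G u) (adj G v) y z ≡ false
  cross-zeroˡ uy uz rewrite uy | uz | ∧-zeroʳ (adj G v y) = refl

  cross-zeroʳ : adj G v y ≡ false → adj G v z ≡ false → cross (adj G u) (adj G v) y z ≡ false
  cross-zeroʳ vy vz rewrite vy | vz | ∧-zeroʳ (adj G u y) = refl

  cross-isolated : adj G u y ≡ false → adj G v y ≡ false → cross (adj G u) (adj G v) y z ≡ false
  cross-isolated uy vy rewrite uy | vy = refl

  cross-twins : adj G u y ≡ adj G v y → adj G u z ≡ adj G v z → cross (adj G u) (adj G v) y z ≡ false
  cross-twins uy uz rewrite uy | uz = xor-same (adj G v y ∧ adj G v z)

adj⇒≢ : (G : Graph) {u v : V G} → adj G u v ≡ true → u ≢ v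
adj⇒≢ G {u} uv refl = case trans (sym (adj-irrefl G u)) uv of λ ()

localComp-adj : (G : Graph) (x : V G) {y z : V G} → y ≢ z
              → adj (localComp G x) y z ≡ adj G y z xor (adj G x y ∧ adj G x z)
localComp-adj G x {y} {z} y≢z
  rewrite dec-false (_≟_ G y z) y≢z = cong (adj G y z xor_) (∧-identityʳ _)

localComp-adj-centre : (G : Graph) (x y : V G) → adj (localComp G x) x y ≡ adj G x y
localComp-adj-centre G x y rewrite adj-irrefl G x = xor-identityʳ (adj G x y)

pivotAdj : (G : Graph) → V G → V G → V G → V G → Bool
pivotAdj G u v y z = adj G y z xor cross (adj G u) (adj G v) y z

pivot-adj : (G : Graph) {u v y z : V G} → adj G u v ≡ true
          → y ≢ u → y ≢ v → z ≢ u → z ≢ v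
          → adj (pivot G u v) y z ≡ pivotAdj G u v y z
pivot-adj G {u} {v} {y} {z} uv y≢u y≢v z≢u z≢v = by-cases (_≟_ G y z)
  where
  open ≡-Reasoning
  open xor-∧-Solver
  G₁ = localComp G u
  G₂ = localComp G₁ v
  G₃ = localComp G₂ u
  uy = adj G u y
  uz = adj G u z
  vy = adj G v y
  vz = adj G v z
  v≢u : v ≢ u
  v≢u = adj⇒≢ G uv ∘ sym
  G₁-v : ∀ {w} → w ≢ v → adj G₁ v w ≡ adj G v w xor adj G u w
  G₁-v {w} w≢v = trans (localComp-adj G u (w≢v ∘ sym)) (cong (λ b → adj G v w xor (b ∧ adj G u w)) uv)
  G₁-vu : adj G₁ v u ≡ true
  G₁-vu = trans (G₁-v (v≢u ∘ sym)) (cong₂ _xor_ (trans (adj-sym G v u) uv) (adj-irrefl G u))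
  G₂-u : ∀ {w} → w ≢ u → w ≢ v → adj G₂ u w ≡ adj G u w xor (adj G v w xor adj G u w)
  G₂-u {w} w≢u w≢v = trans (localComp-adj G₁ v (w≢u ∘ sym))
    (cong₂ _xor_ (localComp-adj-centre G u w) (cong₂ _∧_ G₁-vu (G₁-v w≢v)))
  pivot-identity : ∀ e a b c d →
    ((e xor (a ∧ b)) xor ((c xor a) ∧ (d xor b))) xor ((a xor (c xor a)) ∧ (b xor (d xor b)))
      ≡ e xor ((a ∧ d) xor (c ∧ b))
  pivot-identity = solve 5 (λ e a b c d →
    ((e :+ (a :* b)) :+ ((c :+ a) :* (d :+ b))) :+ ((a :+ (c :+ a)) :* (b :+ (d :+ b)))
      := e :+ ((a :* d) :+ (c :* b))) refl
  by-cases : Dec (y ≡ z) → adj (pivot G u v) y z ≡ pivotAdj G u v y z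
  by-cases (yes refl) = trans (adj-irrefl (pivot G u v) y)
    (sym (cong₂ _xor_ (adj-irrefl G y) (cross-diagonal (adj G u) (adj G v) y)))
  by-cases (no y≢z) = begin
    adj G₃ y z
      ≡⟨ localComp-adj G₂ u y≢z ⟩
    adj G₂ y z xor (adj G₂ u y ∧ adj G₂ u z)
      ≡⟨ cong₂ _xor_ (localComp-adj G₁ v y≢z) (cong₂ _∧_ (G₂-u y≢u y≢v) (G₂-u z≢u z≢v)) ⟩
    (adj G₁ y z xor (adj G₁ v y ∧ adj G₁ v z)) xor
      ((uy xor (vy xor uy)) ∧ (uz xor (vz xor uz)))
      ≡⟨ cong (_xor ((uy xor (vy xor uy)) ∧ (uz xor (vz xor uz))))
              (cong₂ _xor_ (localComp-adj G u y≢z) (cong₂ _∧_ (G₁-v y≢v) (G₁-v z≢v))) ⟩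
    ((adj G y z xor (uy ∧ uz)) xor ((vy xor uy) ∧ (vz xor uz))) xor
      ((uy xor (vy xor uy)) ∧ (uz xor (vz xor uz)))
      ≡⟨ pivot-identity (adj G y z) uy uz vy vz ⟩
    pivotAdj G u v y z ∎

pivot-adj-unchanged : (G : Graph) {u v y z : V G} → adj G u v ≡ true
                    → y ≢ u → y ≢ v → z ≢ u → z ≢ v
                    → cross (adj G u) (adj G v) y z ≡ false
                    → adj (pivot G u v) y z ≡ adj G y z
pivot-adj-unchanged G uv y≢u y≢v z≢u z≢v c =
  trans (pivot-adj G uv y≢u y≢v z≢u z≢v) (trans (cong (adj G _ _ xor_) c) (xor-identityʳ _))

-- Pivot-minors and induced subgraphs

record Adjacency (W : Set) : Set where
  field
    adjacent        : W → W → Bool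
    adjacent-sym    : ∀ u v → adjacent u v ≡ adjacent v u
    adjacent-irrefl : ∀ v → adjacent v v ≡ false

open Adjacency public

infix 25 _⟦_⟧
_⟦_⟧ : (G : Graph) → Adjacency (V G) → Graph
G ⟦ A ⟧ = record
  { V = V G ; _≟_ = _≟_ G
  ; adj = adjacent A ; adj-sym = adjacent-sym A ; adj-irrefl = adjacent-irrefl A }

adjacencyOf : (G : Graph) → Adjacency (V G)
adjacencyOf G = record { adjacent = adj G ; adjacent-sym = adj-sym G ; adjacent-irrefl = adj-irrefl G }

induced : (G : Graph) → (V G → Bool) → Graph
induced G K = record
  { V = Σ (V G) (T ∘ K)
  ; _≟_ = λ (a , p) (b , q) → map′ (λ { refl → cong (a ,_) (T-irr p q) }) (cong proj₁) (_≟_ G a b)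
  ; adj = λ a b → adj G (proj₁ a) (proj₁ b)
  ; adj-sym = λ a b → adj-sym G (proj₁ a) (proj₁ b)
  ; adj-irrefl = λ a → adj-irrefl G (proj₁ a) }

≅-trans : {G H I : Graph} → G ≅ H → H ≅ I → G ≅ I
≅-trans e f = record
  { bij = ↔-trans (_≅_.bij e) (_≅_.bij f)
  ; adj-pres = λ u v → trans (_≅_.adj-pres f _ _) (_≅_.adj-pres e u v) }

pivotMinor-trans : {G H I : Graph} → PivotMinor G H → PivotMinor H I → PivotMinor G I
pivotMinor-trans p pm-refl = p
pivotMinor-trans p (pm-del q v) = pm-del (pivotMinor-trans p q) v
pivotMinor-trans p (pm-pivot q u v uv) = pm-pivot (pivotMinor-trans p q) u v uv

induced-all : (G : Graph) (K : V G → Bool) → (∀ v → T (K v)) → G ≅ induced G K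
induced-all G K inside = record
  { bij = mk↔ₛ′ (λ v → v , inside v) proj₁ (λ (v , p) → cong (v ,_) (T-irr _ _)) (λ _ → refl)
  ; adj-pres = λ _ _ → refl }

T⇒≡ : ∀ {b} → T b → b ≡ true
T⇒≡ = Equivalence.to T-≡

module _ (G : Graph) (x : V G) where

  restrict : V G → Maybe (V (delete G x))
  restrict w = Maybe.map (w ,_) (dec⇒maybe (T? _))

  restrict-kept : ∀ w (p : T (not (does (_≟_ G w x)))) → restrict w ≡ just (w , p)
  restrict-kept w p = cong (Maybe.map (w ,_)) (T?-just _ p)
    where
    T?-just : ∀ b (p : T b) → dec⇒maybe (T? b) ≡ just p
    T?-just true _ = refl

  induced-delete : (K : V G → Bool) → K x ≡ false → induced (delete G x) (K ∘ proj₁) ≅ induced G K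
  induced-delete K Kx = record
    { bij = mk↔ₛ′ (λ ((w , _) , q) → w , q) (λ (w , q) → (w , w≢x w q) , q)
                  (λ _ → refl) (λ ((w , p) , q) → cong (λ p' → (w , p') , q) (T-irr _ _))
    ; adj-pres = λ _ _ → refl }
    where
    w≢x : ∀ w → T (K w) → T (not (does (_≟_ G w x)))
    w≢x w q = subst (T ∘ not) (sym (dec-false (_≟_ G w x) λ { refl → case trans (sym Kx) (T⇒≡ q) of λ () }))
                    _

≢-from-T : {A : Set} (d : Dec A) → T (not (does d)) → ¬ A
≢-from-T (no ¬a) _ = ¬a

covers-tail : ∀ {A : Set} {N} {K : A → Bool} (cover : Fin (suc N) → Maybe A)
            → (∀ v → K v ≡ false → ∃ λ i → cover i ≡ just v)
            → (∀ v → K v ≡ false → cover fzero ≢ just v)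
            → ∀ v → K v ≡ false → ∃ λ i → cover (fsuc i) ≡ just v
covers-tail cover covers not-first v Kv with covers v Kv
... | fzero , e = ⊥-elim (not-first v Kv e)
... | fsuc i , e = i , e

-- cover lists every vertex outside K; its holes stand for vertices deleted earlier.
induced-pivotMinor : ∀ N (G : Graph) (K : V G → Bool) (cover : Fin N → Maybe (V G))
                   → (∀ v → K v ≡ false → ∃ λ i → cover i ≡ just v)
                   → Σ Graph λ H → PivotMinor G H × H ≅ induced G K
induced-pivotMinor zero G K cover covers = G , pm-refl , induced-all G K inside
  where
  inside : ∀ v → T (K v)
  inside v with K v in Kv
  ... | true  = _
  ... | false = case proj₁ (covers v Kv) of λ ()
induced-pivotMinor (suc N) G K cover covers with cover fzero in cover₀
... | nothing = induced-pivotMinor N G K (cover ∘ fsuc)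
  (covers-tail cover covers λ _ _ e → case trans (sym cover₀) e of λ ())
... | just x with K x in Kx
...   | true = induced-pivotMinor N G K (cover ∘ fsuc)
  (covers-tail cover covers λ v Kv e →
    case trans (sym Kx) (trans (cong K (just-injective (trans (sym cover₀) e))) Kv) of λ ())
...   | false =
  extend (induced-pivotMinor N (delete G x) (K ∘ proj₁) (λ i → cover (fsuc i) >>= restrict G x) covers₁)
  where
  extend : (Σ Graph λ H → PivotMinor (delete G x) H × H ≅ induced (delete G x) (K ∘ proj₁))
         → Σ Graph λ H → PivotMinor G H × H ≅ induced G K
  extend (H , minor , H≅) = H , pivotMinor-trans (pm-del pm-refl x) minor , ≅-trans H≅ (induced-delete G x K Kx)
  covers₁ : ∀ v → K (proj₁ v) ≡ false → ∃ λ i → (cover (fsuc i) >>= restrict G x) ≡ just v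
  covers₁ (v , v≢x) Kv with covers v Kv
  ... | fzero , e = ⊥-elim (≢-from-T (_≟_ G v x) v≢x (sym (just-injective (trans (sym cover₀) e))))
  ... | fsuc i , e = i , trans (cong (_>>= restrict G x) e) (restrict-kept G x v v≢x)

-- Contracting an induced path

record InducedPath (G : Graph) (r : ℕ) : Set where
  field
    vertex      : ℕ → V G
    injective   : ∀ {a b} → a ≤ r → b ≤ r → vertex a ≡ vertex b → a ≡ b
    consecutive : ∀ {a} → a < r → adj G (vertex a) (vertex (suc a)) ≡ true
    chordless   : ∀ {a b} → suc a < b → b ≤ r → adj G (vertex a) (vertex b) ≡ false

  first last : V G
  first = vertex 0
  last  = vertex r

open InducedPath public

module _ {G : Graph} (K : V G → Bool) {r : ℕ} (P : InducedPath G r) where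

  Avoids : Set
  Avoids = ∀ {j w} → j ≤ r → T (K w) → w ≢ vertex P j

  InteriorIsolated : Set
  InteriorIsolated = ∀ {j w} → 0 < j → j < r → T (K w) → adj G (vertex P j) w ≡ false

  record PendantTwin (t : V G) : Set where
    field
      off-K        : ∀ {w} → T (K w) → w ≢ t
      off-path     : ∀ {j} → j ≤ r → t ≢ vertex P j
      pendant      : adj G t (first P) ≡ true
      pendant-only : ∀ {j} → 0 < j → j ≤ r → adj G t (vertex P j) ≡ false
      twin         : ∀ {w} → T (K w) → adj G t w ≡ adj G (first P) w

-- On K, G ⟦ adjacency ⟧ looks as if ab were an edge of G and had been pivoted.
record Contraction (G : Graph) (K : V G → Bool) (a b : V G) : Set₁ where
  constructor contraction
  field
    adjacency : Adjacency (V G)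
    minor     : PivotMinor G (G ⟦ adjacency ⟧)
    on-K      : ∀ {w z} → T (K w) → T (K z) → adjacent adjacency w z ≡ pivotAdj G a b w z

contraction-pivot : (G : Graph) (K : V G → Bool) {u v a b a' b' : V G} → adj G u v ≡ true
  → Contraction (pivot G u v) K a' b'
  → (∀ {w z} → T (K w) → T (K z) → adj (pivot G u v) w z ≡ adj G w z)
  → (∀ {w} → T (K w) → adj (pivot G u v) a' w ≡ adj G a w)
  → (∀ {w} → T (K w) → adj (pivot G u v) b' w ≡ adj G b w)
  → Contraction G K a b
contraction-pivot G K uv (contraction A minor agrees) K-same a'≈a b'≈b =
  contraction A (pivotMinor-trans (pm-pivot pm-refl _ _ uv) minor)
  λ Kw Kz → trans (agrees Kw Kz)
    (cong₂ _xor_ (K-same Kw Kz)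
      (cong₂ _xor_ (cong₂ _∧_ (a'≈a Kw) (b'≈b Kz)) (cong₂ _∧_ (b'≈b Kw) (a'≈a Kz))))

data Odd : ℕ → Set where
  one : Odd 1
  2+_ : ∀ {n} → Odd n → Odd (2 + n)

parity : ∀ n → Odd n ⊎ Odd (suc n)
parity zero = inj₂ one
parity (suc n) with parity n
... | inj₁ odd = inj₂ (2+ odd)
... | inj₂ odd = inj₁ odd

odd⇒positive : ∀ {n} → Odd n → 0 < n
odd⇒positive one = s≤s z≤n
odd⇒positive (2+ _) = s≤s z≤n

tail : ∀ {G r} → InducedPath G (suc r) → InducedPath G r
tail P = record
  { vertex = vertex P ∘ suc
  ; injective = λ a≤r b≤r e → suc-injective (injective P (s≤s a≤r) (s≤s b≤r) e)
  ; consecutive = λ a<r → consecutive P (s≤s a<r)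
  ; chordless = λ a+1<b b≤r → chordless P (s≤s a+1<b) (s≤s b≤r) }

module PivotAway {G : Graph} {r} (P : InducedPath G r) {u v : V G} (uv : adj G u v ≡ true)
  (≢u : ∀ {j} → j ≤ r → vertex P j ≢ u) (≢v : ∀ {j} → j ≤ r → vertex P j ≢ v)
  (u-far : ∀ {j} → j ≤ r → adj G u (vertex P j) ≡ false) where

  path : InducedPath (pivot G u v) r
  path = record
    { vertex = vertex P
    ; injective = injective P
    ; consecutive = λ a<r → trans (unchanged (<⇒≤ a<r) a<r) (consecutive P a<r)
    ; chordless = λ a+1<b b≤r →
        trans (unchanged (≤-trans (n≤1+n _) (<⇒≤ (<-≤-trans a+1<b b≤r))) b≤r) (chordless P a+1<b b≤r) }
    where
    unchanged : ∀ {a b} → a ≤ r → b ≤ r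
              → adj (pivot G u v) (vertex P a) (vertex P b) ≡ adj G (vertex P a) (vertex P b)
    unchanged a≤r b≤r = pivot-adj-unchanged G uv (≢u a≤r) (≢v a≤r) (≢u b≤r) (≢v b≤r)
      (cross-zeroˡ G (u-far a≤r) (u-far b≤r))

  adj-unchanged : ∀ {j w} → j ≤ r → w ≢ u → w ≢ v → adj G v (vertex P j) ≡ false
                → adj (pivot G u v) (vertex P j) w ≡ adj G (vertex P j) w
  adj-unchanged j≤r w≢u w≢v v-far = pivot-adj-unchanged G uv (≢u j≤r) (≢v j≤r) w≢u w≢v
    (cross-isolated G (u-far j≤r) v-far)

-- Pivoting y₀y₁ leaves K untouched, as y₁ has no K-neighbours, and gives y₂ the
-- K-neighbourhood of y₀: the path becomes two shorter.
contract-odd : ∀ {G K r} → Odd r → (P : InducedPath G r) → Avoids K P → InteriorIsolated K P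
             → Contraction G K (first P) (last P)
contract-odd {G} one P avoids _ =
  contraction (adjacencyOf (pivot G (first P) (last P))) (pm-pivot pm-refl _ _ y₀y₁)
  λ Kw Kz → pivot-adj G y₀y₁ (avoids z≤n Kw) (avoids ≤-refl Kw) (avoids z≤n Kz) (avoids ≤-refl Kz)
  where
  y₀y₁ = consecutive P (s≤s z≤n)
contract-odd {G} {K} {suc (suc r)} (2+ odd) P avoids isolated =
  contraction-pivot G K y₀y₁ (contract-odd odd P' avoids' isolated') K-same first' last'
  where
  y = vertex P
  y₀y₁ = consecutive P (s≤s z≤n)
  ≤2+ : ∀ {i j} → i ≤ j → 2 + i ≤ 2 + j
  ≤2+ = s≤s ∘ s≤s
  0<r = odd⇒positive odd
  K≢y₀ : ∀ {w} → T (K w) → w ≢ y 0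
  K≢y₀ = avoids z≤n
  K≢y₁ : ∀ {w} → T (K w) → w ≢ y 1
  K≢y₁ = avoids (s≤s z≤n)
  y₁-isolated : ∀ {w} → T (K w) → adj G (y 1) w ≡ false
  y₁-isolated = isolated (s≤s z≤n) (s≤s (s≤s z≤n))
  y₀-far : ∀ {j} → j ≤ r → adj G (y 0) (y (2 + j)) ≡ false
  y₀-far j≤r = chordless P (s≤s (s≤s z≤n)) (≤2+ j≤r)
  y₁-far : ∀ {j} → 0 < j → j ≤ r → adj G (y 1) (y (2 + j)) ≡ false
  y₁-far (s≤s _) j≤r = chordless P (s≤s (s≤s (s≤s z≤n))) (≤2+ j≤r)
  y≢y₀ : ∀ {j} → j ≤ r → y (2 + j) ≢ y 0
  y≢y₀ j≤r e = case injective P (≤2+ j≤r) z≤n e of λ ()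
  y≢y₁ : ∀ {j} → j ≤ r → y (2 + j) ≢ y 1
  y≢y₁ j≤r e = case injective P (≤2+ j≤r) (s≤s z≤n) e of λ ()
  open PivotAway (tail (tail P)) y₀y₁ y≢y₀ y≢y₁ y₀-far renaming (path to P')
  avoids' : Avoids K P'
  avoids' j≤r = avoids (≤2+ j≤r)
  isolated' : InteriorIsolated K P'
  isolated' 0<j j<r Kw = trans (adj-unchanged (<⇒≤ j<r) (K≢y₀ Kw) (K≢y₁ Kw) (y₁-far 0<j (<⇒≤ j<r)))
                               (isolated (s≤s z≤n) (≤2+ j<r) Kw)
  K-same : ∀ {w z} → T (K w) → T (K z) → adj (pivot G (y 0) (y 1)) w z ≡ adj G w z
  K-same Kw Kz = pivot-adj-unchanged G y₀y₁ (K≢y₀ Kw) (K≢y₁ Kw) (K≢y₀ Kz) (K≢y₁ Kz)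
    (cross-zeroʳ G (y₁-isolated Kw) (y₁-isolated Kz))
  first' : ∀ {w} → T (K w) → adj (pivot G (y 0) (y 1)) (y 2) w ≡ adj G (y 0) w
  first' {w} Kw = trans (pivot-adj G y₀y₁ (y≢y₀ z≤n) (y≢y₁ z≤n) (K≢y₀ Kw) (K≢y₁ Kw))
    (cong₂ _xor_ (isolated (s≤s z≤n) (≤2+ 0<r) Kw)
      (cong₂ _xor_ (cong (_∧ adj G (y 1) w) (y₀-far z≤n))
                   (cong (_∧ adj G (y 0) w) (consecutive P (s≤s (s≤s z≤n))))))
  last' : ∀ {w} → T (K w) → adj (pivot G (y 0) (y 1)) (y (2 + r)) w ≡ adj G (y (2 + r)) w
  last' Kw = adj-unchanged ≤-refl (K≢y₀ Kw) (K≢y₁ Kw) (y₁-far 0<r ≤-refl)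

-- For a path of even length, first pivot t y₀: since t and y₀ are K-twins this leaves K
-- untouched, and y₁ inherits the K-neighbourhood of y₀.
contract : ∀ {G K r} → 0 < r → (P : InducedPath G r) → Avoids K P → InteriorIsolated K P
         → ∀ {t} → PendantTwin K P t → Contraction G K (first P) (last P)
contract {G} {K} {suc r} _ P avoids isolated {t} pendantTwin with parity r
... | inj₂ odd = contract-odd odd P avoids isolated
... | inj₁ odd = contraction-pivot G K pendant (contract-odd odd P' avoids' isolated') K-same first' last'
  where
  open PendantTwin pendantTwin
  y = vertex P
  0<r = odd⇒positive odd
  y≢t : ∀ {j} → j ≤ r → y (suc j) ≢ t
  y≢t j≤r = off-path (s≤s j≤r) ∘ sym
  y≢y₀ : ∀ {j} → j ≤ r → y (suc j) ≢ y 0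
  y≢y₀ j≤r e = case injective P (s≤s j≤r) z≤n e of λ ()
  t-far : ∀ {j} → j ≤ r → adj G t (y (suc j)) ≡ false
  t-far j≤r = pendant-only (s≤s z≤n) (s≤s j≤r)
  y₀-far : ∀ {j} → 0 < j → j ≤ r → adj G (y 0) (y (suc j)) ≡ false
  y₀-far (s≤s _) j≤r = chordless P (s≤s (s≤s z≤n)) (s≤s j≤r)
  K≢y₀ : ∀ {w} → T (K w) → w ≢ y 0
  K≢y₀ = avoids z≤n
  open PivotAway (tail P) pendant y≢t y≢y₀ t-far renaming (path to P')
  avoids' : Avoids K P'
  avoids' j≤r = avoids (s≤s j≤r)
  isolated' : InteriorIsolated K P'
  isolated' 0<j j<r Kw = trans (adj-unchanged (<⇒≤ j<r) (off-K Kw) (K≢y₀ Kw) (y₀-far 0<j (<⇒≤ j<r)))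
                               (isolated (s≤s z≤n) (s≤s j<r) Kw)
  K-same : ∀ {w z} → T (K w) → T (K z) → adj (pivot G t (y 0)) w z ≡ adj G w z
  K-same Kw Kz = pivot-adj-unchanged G pendant (off-K Kw) (K≢y₀ Kw) (off-K Kz) (K≢y₀ Kz)
    (cross-twins G (twin Kw) (twin Kz))
  first' : ∀ {w} → T (K w) → adj (pivot G t (y 0)) (y 1) w ≡ adj G (y 0) w
  first' {w} Kw = trans (pivot-adj G pendant (y≢t z≤n) (y≢y₀ z≤n) (off-K Kw) (K≢y₀ Kw))
    (trans (cong₂ _xor_ (isolated (s≤s z≤n) (s≤s 0<r) Kw)
             (cong₂ _xor_ (cong (_∧ adj G (y 0) w) (t-far z≤n))
                          (cong (_∧ adj G t w) (consecutive P (s≤s z≤n)))))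
           (twin Kw))
  last' : ∀ {w} → T (K w) → adj (pivot G t (y 0)) (y (suc r)) w ≡ adj G (y (suc r)) w
  last' Kw = adj-unchanged ≤-refl (off-K Kw) (K≢y₀ Kw) (y₀-far 0<r ≤-refl)

-- Z-paths in a flipped mP_n

module _ {G : Graph} {Z A B : V G → Bool} (π : ZPath G Z A B) where
  open ZPath π

  private
    position : ℕ → Fin (suc r)
    position j = fromℕ< (s≤s (m⊓n≤n j r))

    toℕ-position : ∀ {j} → j ≤ r → toℕ (position j) ≡ j
    toℕ-position {j} j≤r = trans (toℕ-fromℕ< _) (m≤n⇒m⊓n≡m j≤r)

    position-of : ∀ {j} → j ≤ r → (i : Fin (suc r)) → toℕ i ≡ j → position j ≡ i
    position-of j≤r i e = toℕ-injective (trans (toℕ-position j≤r) (sym e))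

  -- clamped to the last vertex of π beyond r
  at : ℕ → V G
  at j = p (position j)

  at-injective : ∀ {a b} → a ≤ r → b ≤ r → at a ≡ at b → a ≡ b
  at-injective a≤r b≤r e =
    trans (sym (toℕ-position a≤r)) (trans (cong toℕ (ZPath.injective π _ _ e)) (toℕ-position b≤r))

  at-step : ∀ {a} → a < r → adj G (at a) (at (suc a)) ≡ true
  at-step a<r = subst₂ (λ i i' → adj G (p i) (p i') ≡ true)
    (sym (position-of (<⇒≤ a<r) _ (trans (toℕ-inject₁ _) (toℕ-fromℕ< a<r))))
    (sym (position-of a<r _ (cong suc (toℕ-fromℕ< a<r))))
    (step (fromℕ< a<r))

  at-start : A (at 0) ≡ true
  at-start = subst (λ i → A (p i) ≡ true) (sym (position-of z≤n fzero refl)) start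

  at-end : B (at r) ≡ true
  at-end = subst (λ i → B (p i) ≡ true) (sym (position-of ≤-refl (fromℕ r) (toℕ-fromℕ r))) end

  at-internal : ∀ {j} → 0 < j → j < r → Z (at j) ≡ false
  at-internal 0<j j<r = internal (position _) (subst (0 <_) (sym e) 0<j) (subst (_< r) (sym e) j<r)
    where e = toℕ-position (<⇒≤ j<r)

row : ∀ {M n} → Fin M × Fin n → Fin M
row = proj₁

column : ∀ {M n} → Fin M × Fin n → ℕ
column = toℕ ∘ proj₂

module _ {M n : ℕ} where

  pathAdj-row : ∀ v w → pathAdj M n v w ≡ true → row v ≡ row w
  pathAdj-row (i , _) (i' , _) e with i Fin.≟ i'
  ... | yes i≡i' = i≡i'

  pathAdj-column : ∀ v w → pathAdj M n v w ≡ true → suc (column v) ≡ column w ⊎ suc (column w) ≡ column v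
  pathAdj-column (i , j) (i' , j') e with i Fin.≟ i' | suc (toℕ j) ≡ᵇ toℕ j' in right
  ... | yes _ | true  = inj₁ (≡ᵇ⇒≡ _ _ (subst T (sym right) _))
  ... | yes _ | false = inj₂ (≡ᵇ⇒≡ _ _ (subst T (sym e) _))

  private
    same-column : ∀ v a b → pathAdj M n v a ≡ true → pathAdj M n v b ≡ true → column a ≡ column b → a ≡ b
    same-column v a b va vb e = cong₂ _,_ (trans (sym (pathAdj-row v a va)) (pathAdj-row v b vb)) (toℕ-injective e)

  pathAdj-degree≤2 : ∀ v a b c → pathAdj M n v a ≡ true → pathAdj M n v b ≡ true → pathAdj M n v c ≡ true
                   → a ≡ b ⊎ a ≡ c ⊎ b ≡ c
  pathAdj-degree≤2 v a b c va vb vc with pathAdj-column v a va | pathAdj-column v b vb | pathAdj-column v c vc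
  ... | inj₁ x | inj₁ y | _      = inj₁ (same-column v a b va vb (trans (sym x) y))
  ... | inj₂ x | inj₂ y | _      = inj₁ (same-column v a b va vb (suc-injective (trans x (sym y))))
  ... | inj₁ x | inj₂ _ | inj₁ z = inj₂ (inj₁ (same-column v a c va vc (trans (sym x) z)))
  ... | inj₁ _ | inj₂ y | inj₂ z = inj₂ (inj₂ (same-column v b c vb vc (suc-injective (trans y (sym z)))))
  ... | inj₂ _ | inj₁ y | inj₁ z = inj₂ (inj₂ (same-column v b c vb vc (trans (sym y) z)))
  ... | inj₂ x | inj₁ _ | inj₂ z = inj₂ (inj₁ (same-column v a c va vc (suc-injective (trans x (sym z)))))

pathAdj-rows : ∀ {m M n} (ρ : Fin m → Fin M) → (∀ {a a'} → ρ a ≡ ρ a' → a ≡ a')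
             → ∀ a b a' b' → pathAdj M n (ρ a , b) (ρ a' , b') ≡ pathAdj m n (a , b) (a' , b')
pathAdj-rows ρ ρ-injective a b a' b' =
  cong (_∧ _) (does-⇔ (mk⇔ ρ-injective (cong ρ)) (ρ a Fin.≟ ρ a') (a Fin.≟ a'))

module _ {M n k : ℕ} (C : Coarsening n k) (F : Fin k → Fin k → Bool) (Fs : ∀ a b → F a b ≡ F b a) where

  private
    G = flipMP M n k C F Fs

  flip-unflipped : ∀ v w → inF F (colPart C v) (colPart C w) ≡ false → adj G v w ≡ pathAdj M n v w
  flip-unflipped v w e rewrite e = xor-identityʳ (pathAdj M n v w)

  flip-rows : ∀ v w → row v ≢ row w → adj G v w ≡ inF F (colPart C v) (colPart C w)
  flip-rows v w rows
    rewrite dec-false (row v Fin.≟ row w) rows | dec-false (_≟_ G v w) (rows ∘ cong row) =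
    ∧-identityʳ _

  outside-adj : ∀ v w → colPart C v ≡ nothing → adj G v w ≡ true → pathAdj M n v w ≡ true
  outside-adj v w out e = trans (sym (flip-unflipped v w (cong (λ q → inF F q (colPart C w)) out))) e

  record RowPath (X X' : Fin k) : Set where
    field
      length   : ℕ
      positive : 0 < length
      path     : InducedPath G length
      in-row   : ∀ {j} → j ≤ length → row (vertex path j) ≡ row (first path)
      starts   : colPart C (first path) ≡ just X
      ends     : colPart C (last path) ≡ just X'
      interior : ∀ {j} → 0 < j → j < length → colPart C (vertex path j) ≡ nothing

  member-part : ∀ {X} (v : Fin M × Fin n) → inMember C X v ≡ true → colPart C v ≡ just X
  member-part {X} (_ , j) with part C j
  ... | just Y with Y Fin.≟ X
  ...   | yes Y≡X = λ _ → cong just Y≡X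
  ...   | no _    = λ ()

  outside-part : ∀ (v : Fin M × Fin n) → inUnion C v ≡ false → colPart C v ≡ nothing
  outside-part (_ , j) with part C j
  ... | nothing = λ _ → refl

  module _ {X X' : Fin k} (X≢X' : X ≢ X') (FXX' : F X X' ≡ false)
           (π : ZPath G (inUnion C) (inMember C X) (inMember C X')) where

    private
      r = ZPath.r π
      y = at π

      y₀-part : colPart C (y 0) ≡ just X
      y₀-part = member-part (y 0) (at-start π)

      yᵣ-part : colPart C (y r) ≡ just X'
      yᵣ-part = member-part (y r) (at-end π)

      interior-part : ∀ {j} → 0 < j → j < r → colPart C (y j) ≡ nothing
      interior-part 0<j j<r = outside-part (y _) (at-internal π 0<j j<r)

      y₀≢yᵣ : y 0 ≢ y r
      y₀≢yᵣ e = X≢X' (just-injective (trans (sym y₀-part) (trans (cong (colPart C) e) yᵣ-part)))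

      0<r : 0 < r
      0<r with r in r≡
      ... | zero  = ⊥-elim (y₀≢yᵣ (cong y (sym r≡)))
      ... | suc _ = s≤s z≤n

      edge-path : adj G (y 0) (y r) ≡ true → RowPath X X'
      edge-path y₀yᵣ = record
        { length = 1 ; positive = s≤s z≤n ; path = path
        ; in-row = λ { z≤n → refl ; (s≤s z≤n) → sym (pathAdj-row (y 0) (y r) edge) }
        ; starts = y₀-part ; ends = yᵣ-part
        ; interior = λ { (s≤s _) (s≤s ()) } }
        where
        ends : ℕ → V G
        ends zero = y 0
        ends (suc _) = y r
        edge : pathAdj M n (y 0) (y r) ≡ true
        edge = trans (sym (flip-unflipped (y 0) (y r) (trans (cong₂ (inF F) y₀-part yᵣ-part) FXX'))) y₀yᵣ
        path : InducedPath G 1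
        path = record
          { vertex = ends
          ; injective = λ { z≤n z≤n _ → refl ; (s≤s z≤n) (s≤s z≤n) _ → refl
                          ; z≤n (s≤s z≤n) e → ⊥-elim (y₀≢yᵣ e)
                          ; (s≤s z≤n) z≤n e → ⊥-elim (y₀≢yᵣ (sym e)) }
          ; consecutive = λ { (s≤s z≤n) → y₀yᵣ }
          ; chordless = λ { (s≤s (s≤s _)) (s≤s ()) } }

      module Chordless (y₀≁yᵣ : adj G (y 0) (y r) ≡ false) where

        1<r : 1 < r
        1<r = ≤∧≢⇒< 0<r λ 1≡r →
          case trans (sym (at-step π 0<r)) (subst (λ j → adj G (y 0) (y j) ≡ false) (sym 1≡r) y₀≁yᵣ) of λ ()

        step-pathAdj : ∀ {a} → a < r → pathAdj M n (y a) (y (suc a)) ≡ true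
        step-pathAdj {zero} _ = trans (adj-sym (mP M n) (y 0) (y 1))
          (outside-adj (y 1) (y 0) (interior-part (s≤s z≤n) 1<r) (trans (adj-sym G (y 1) (y 0)) (at-step π 0<r)))
        step-pathAdj {suc a} a<r =
          outside-adj (y (suc a)) (y (suc (suc a))) (interior-part (s≤s z≤n) a<r) (at-step π a<r)

        in-row : ∀ {j} → j ≤ r → row (y j) ≡ row (y 0)
        in-row {zero} _ = refl
        in-row {suc j} j<r = trans (sym (pathAdj-row (y j) (y (suc j)) (step-pathAdj j<r))) (in-row (<⇒≤ j<r))

        interior-neighbours : ∀ {c l} → suc c < r → l ≤ r → adj G (y (suc c)) (y l) ≡ true
                            → l ≡ c ⊎ l ≡ suc (suc c)
        interior-neighbours {c} {l} c+1<r l≤r e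
          with pathAdj-degree≤2 (y (suc c)) (y c) (y (suc (suc c))) (y l)
                 (trans (adj-sym (mP M n) (y (suc c)) (y c)) (step-pathAdj c<r)) (step-pathAdj c+1<r)
                 (outside-adj (y (suc c)) (y l) (interior-part (s≤s z≤n) c+1<r) e)
          where c<r = <-trans (n<1+n c) c+1<r
        ... | inj₁ q = ⊥-elim (<-irrefl (at-injective π (<⇒≤ (<-trans (n<1+n c) c+1<r)) c+1<r q)
                                        (<-trans (n<1+n c) (n<1+n (suc c))))
        ... | inj₂ (inj₁ q) = inj₁ (sym (at-injective π (<⇒≤ (<-trans (n<1+n c) c+1<r)) l≤r q))
        ... | inj₂ (inj₂ q) = inj₂ (sym (at-injective π c+1<r l≤r q))

        no-chord : ∀ {a b} → suc a < b → b ≤ r → adj G (y a) (y b) ≡ true → ⊥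
        no-chord {suc c} {b} a+1<b b≤r ab with interior-neighbours (<-trans (n<1+n _) (<-≤-trans a+1<b b≤r)) b≤r ab
        ... | inj₁ b≡c = <-irrefl (sym b≡c) (<-trans (n<1+n c) (<-trans (n<1+n (suc c)) a+1<b))
        ... | inj₂ b≡c+2 = <-irrefl (sym b≡c+2) a+1<b
        no-chord {zero} {suc c} (s≤s 1≤c) b≤r ab with suc c ℕ.≟ r
        ... | yes b≡r =
          case trans (sym ab) (subst (λ j → adj G (y 0) (y j) ≡ false) (sym b≡r) y₀≁yᵣ) of λ ()
        ... | no b≢r with interior-neighbours (≤∧≢⇒< b≤r b≢r) z≤n (trans (adj-sym G (y (suc c)) (y 0)) ab)
        ...   | inj₁ 0≡c = case subst (1 ≤_) (sym 0≡c) 1≤c of λ ()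

        no-chords : ∀ {a b} → suc a < b → b ≤ r → adj G (y a) (y b) ≡ false
        no-chords {a} {b} a+1<b b≤r with adj G (y a) (y b) in ab
        ... | false = refl
        ... | true  = ⊥-elim (no-chord a+1<b b≤r ab)

        zpath-path : RowPath X X'
        zpath-path = record
          { length = r ; positive = 0<r
          ; path = record { vertex = y ; injective = at-injective π ; consecutive = at-step π ; chordless = no-chords }
          ; in-row = in-row ; starts = y₀-part ; ends = yᵣ-part ; interior = interior-part }

    -- If its ends are adjacent, that edge is the path; otherwise the Z-path itself is induced.
    toRowPath : RowPath X X'
    toRowPath with adj G (y 0) (y r) in y₀yᵣ
    ... | true  = edge-path y₀yᵣ
    ... | false = Chordless.zpath-path y₀yᵣ

-- Deleting rows and merging parts

module Rows {m n : ℕ} (i : Fin (2 + m)) where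

  spare : Fin (2 + m)
  spare = punchIn i fzero

  keep : Fin m → Fin (2 + m)
  keep a = punchIn i (fsuc a)

  private
    unsuc : Fin (suc m) → Maybe (Fin m)
    unsuc fzero    = nothing
    unsuc (fsuc a) = just a

  index : Fin (2 + m) → Maybe (Fin m)
  index q with i Fin.≟ q
  ... | yes _   = nothing
  ... | no i≢q = unsuc (punchOut i≢q)

  keep-injective : ∀ {a b} → keep a ≡ keep b → a ≡ b
  keep-injective e = fsuc-injective (punchIn-injective i _ _ e)

  keep≢i : ∀ a → keep a ≢ i
  keep≢i a = punchInᵢ≢i i (fsuc a)

  keep≢spare : ∀ a → keep a ≢ spare
  keep≢spare a e = case punchIn-injective i _ _ e of λ ()

  spare≢i : spare ≢ i
  spare≢i = punchInᵢ≢i i fzero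

  index-keep : ∀ a → index (keep a) ≡ just a
  index-keep a with i Fin.≟ keep a
  ... | yes i≡ = ⊥-elim (keep≢i a (sym i≡))
  ... | no i≢ = cong unsuc (trans (punchOut-cong i refl) (punchOut-punchIn i))

  keep-index : ∀ {q a} → index q ≡ just a → keep a ≡ q
  keep-index {q} e with i Fin.≟ q
  ... | no i≢q with punchOut i≢q in p
  ...   | fsuc a' = trans (cong keep (sym (just-injective e)))
                          (trans (cong (punchIn i) (sym p)) (punchIn-punchOut i≢q))

  kept : Fin (2 + m) × Fin n → Bool
  kept (q , _) = is-just (index q)

  kept-keep : ∀ a {b : Fin n} → T (kept (keep a , b))
  kept-keep a = subst (T ∘ is-just) (sym (index-keep a)) _

  kept-row : ∀ (v : Fin (2 + m) × Fin n) → T (kept v) → Σ (Fin m) λ a → keep a ≡ proj₁ v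
  kept-row (q , _) t with index q in e
  ... | just a = a , keep-index e

  rows-≅ : (A : Adjacency (Fin (2 + m) × Fin n)) (H : Adjacency (Fin m × Fin n))
         → (∀ a b a' b' → adjacent A (keep a , b) (keep a' , b') ≡ adjacent H (a , b) (a' , b'))
         → induced (mP (2 + m) n ⟦ A ⟧) kept ≅ mP m n ⟦ H ⟧
  rows-≅ A H same = record
    { bij = mk↔ₛ′ to from
        (λ (a , b) → cong (_, b) (keep-injective (proj₂ (kept-row (keep a , b) (kept-keep a {b})))))
        (λ ((q , b) , t) → Σ-≡ (cong (_, b) (proj₂ (kept-row (q , b) t))))
    ; adj-pres = λ ((q , b) , t) ((q' , b') , t') →
        trans (sym (same _ b _ b'))
              (cong₂ (λ p p' → adjacent A (p , b) (p' , b'))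
                     (proj₂ (kept-row (q , b) t)) (proj₂ (kept-row (q' , b') t'))) }
    where
    to : Σ (Fin (2 + m) × Fin n) (T ∘ kept) → Fin m × Fin n
    to ((q , b) , t) = proj₁ (kept-row (q , b) t) , b
    from : Fin m × Fin n → Σ (Fin (2 + m) × Fin n) (T ∘ kept)
    from (a , b) = (keep a , b) , kept-keep a {b}
    Σ-≡ : ∀ {v v' : Fin (2 + m) × Fin n} {t : T (kept v)} {t' : T (kept v')}
        → v ≡ v' → _≡_ {A = Σ _ (T ∘ kept)} (v , t) (v' , t')
    Σ-≡ {v} refl = cong (v ,_) (T-irr _ _)

module _ {k : ℕ} (F : Fin k → Fin k → Bool) (X X' : Fin k) where

  crossFlip : Fin k → Fin k → Bool
  crossFlip Z W = F Z W xor cross (F X) (F X') Z W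

  crossFlip-sym : (∀ a b → F a b ≡ F b a) → ∀ Z W → crossFlip Z W ≡ crossFlip W Z
  crossFlip-sym Fs Z W = cong₂ _xor_ (Fs Z W) (cross-sym (F X) (F X') Z W)

  crossFlip-twins : (∀ a b → F a b ≡ F b a) → F X X ≡ true → F X' X' ≡ true → F X X' ≡ false
                  → ∀ W → crossFlip X W ≡ crossFlip X' W
  crossFlip-twins Fs FXX FX'X' FXX' W rewrite FXX | FX'X' | Fs X' X | FXX' =
    trans (cong (F X W xor_) (xor-identityʳ (F X' W))) (xor-comm (F X W) (F X' W))

  inF-crossFlip : ∀ a b → inF crossFlip a b ≡ inF F a b xor cross (inF F (just X)) (inF F (just X')) a b
  inF-crossFlip (just Z) (just W) = refl
  inF-crossFlip (just Z) nothing rewrite ∧-zeroʳ (F X Z) | ∧-zeroʳ (F X' Z) = refl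
  inF-crossFlip nothing  _ = refl

module Merge {k : ℕ} (F : Fin (suc k) → Fin (suc k) → Bool) (Fs : ∀ a b → F a b ≡ F b a)
         {X X' : Fin (suc k)} (X≢X' : X ≢ X') (twins : ∀ W → F X W ≡ F X' W) where

  merge : Fin (suc k) → Fin k
  merge Z with Z Fin.≟ X'
  ... | yes _    = punchOut (X≢X' ∘ sym)
  ... | no Z≢X' = punchOut (Z≢X' ∘ sym)

  merge-punchIn : ∀ a → merge (punchIn X' a) ≡ a
  merge-punchIn a with punchIn X' a Fin.≟ X'
  ... | yes e = ⊥-elim (punchInᵢ≢i X' a e)
  ... | no _  = trans (punchOut-cong X' refl) (punchOut-punchIn X')

  punchIn-merge : ∀ Z W → F (punchIn X' (merge Z)) W ≡ F Z W
  punchIn-merge Z W with Z Fin.≟ X'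
  ... | yes refl = trans (cong (λ Y → F Y W) (punchIn-punchOut _)) (twins W)
  ... | no _     = cong (λ Y → F Y W) (punchIn-punchOut _)

  mergedF : Fin k → Fin k → Bool
  mergedF a b = F (punchIn X' a) (punchIn X' b)

  mergedF-sym : ∀ a b → mergedF a b ≡ mergedF b a
  mergedF-sym a b = Fs (punchIn X' a) (punchIn X' b)

  inF-merge : ∀ a b → inF mergedF (Maybe.map merge a) (Maybe.map merge b) ≡ inF F a b
  inF-merge (just Z) (just W) =
    trans (punchIn-merge Z _) (trans (Fs Z _) (trans (punchIn-merge W Z) (Fs W Z)))
  inF-merge (just _) nothing  = refl
  inF-merge nothing  _        = refl

  mergeCoarsening : ∀ {n} → Coarsening n (suc k) → Coarsening n k
  mergeCoarsening C = record
    { part = Maybe.map merge ∘ part C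
    ; nonempty = λ a → proj₁ (nonempty C (punchIn X' a)) ,
        trans (cong (Maybe.map merge) (proj₂ (nonempty C (punchIn X' a)))) (cong just (merge-punchIn a)) }

flipMP-≅ : ∀ {m n k k'} (C : Coarsening n k) (F : Fin k → Fin k → Bool) Fs
                        (C' : Coarsening n k') (F' : Fin k' → Fin k' → Bool) Fs'
         → (∀ j j' → inF F' (part C' j) (part C' j') ≡ inF F (part C j) (part C j'))
         → flipMP m n k C F Fs ≅ flipMP m n k' C' F' Fs'
flipMP-≅ {m} {n} _ _ _ _ _ _ e = record
  { bij = ↔-refl
  ; adj-pres = λ v w →
      cong (λ b → pathAdj m n v w xor (b ∧ not (does (_≟_ (mP m n) v w)))) (e (proj₂ v) (proj₂ w)) }

module _ {m n k : ℕ} (C : Coarsening n k) (F : Fin k → Fin k → Bool) (Fs : ∀ a b → F a b ≡ F b a) where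

  flipMP-rows : ∀ {M} (ρ : Fin m → Fin M) → (∀ {a b} → ρ a ≡ ρ b → a ≡ b)
              → ∀ a b a' b'
              → adj (flipMP M n k C F Fs) (ρ a , b) (ρ a' , b') ≡ adj (flipMP m n k C F Fs) (a , b) (a' , b')
  flipMP-rows {M} ρ ρ-injective a b a' b' =
    cong₂ (λ p d → p xor (inF F (part C b) (part C b') ∧ not d))
      (pathAdj-rows ρ ρ-injective a b a' b')
      (does-⇔ (mk⇔ (λ e → cong₂ _,_ (ρ-injective (cong proj₁ e)) (cong proj₂ e)) (cong λ (a , b) → ρ a , b))
              (_≟_ (mP M n) (ρ a , b) (ρ a' , b')) (_≟_ (mP m n) (a , b) (a' , b')))

  flipMP-crossFlip : ∀ X X' (Fs' : ∀ a b → crossFlip F X X' a b ≡ crossFlip F X X' b a) v w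
    → adj (flipMP m n k C (crossFlip F X X') Fs') v w
      ≡ adj (flipMP m n k C F Fs) v w xor cross (inF F (just X) ∘ colPart C) (inF F (just X') ∘ colPart C) v w
  flipMP-crossFlip X X' Fs' v w = by-cases (_≟_ (mP m n) v w)
    where
    by-cases : Dec (v ≡ w) → adj (flipMP m n k C (crossFlip F X X') Fs') v w
      ≡ adj (flipMP m n k C F Fs) v w xor cross (inF F (just X) ∘ colPart C) (inF F (just X') ∘ colPart C) v w
    by-cases (yes refl) = trans (adj-irrefl (flipMP m n k C (crossFlip F X X') Fs') v)
      (sym (cong₂ _xor_ (adj-irrefl (flipMP m n k C F Fs) v)
                        (cross-diagonal (inF F (just X) ∘ colPart C) (inF F (just X') ∘ colPart C) v)))
    by-cases (no v≢w) rewrite dec-false (_≟_ (mP m n) v w) v≢w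
                            | ∧-identityʳ (inF (crossFlip F X X') (colPart C v) (colPart C w))
                            | ∧-identityʳ (inF F (colPart C v) (colPart C w)) =
      trans (cong (pathAdj m n v w xor_) (inF-crossFlip F X X' (colPart C v) (colPart C w)))
            (sym (xor-assoc (pathAdj m n v w) _ _))

module Collapse {m n k : ℕ} (C : Coarsening n k) (F : Fin k → Fin k → Bool) (Fs : ∀ a b → F a b ≡ F b a)
  {X X' : Fin k} (X≢X' : X ≢ X') (FXX : F X X ≡ true) (FXX' : F X X' ≡ false)
  (π : ZPath (flipMP (2 + m) n k C F Fs) (inUnion C) (inMember C X) (inMember C X')) where

  private
    G = flipMP (2 + m) n k C F Fs
    F' = crossFlip F X X'
    Fs' = crossFlip-sym F X X' Fs
  open RowPath (toRowPath C F Fs X≢X' FXX' π)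
  open Rows {n = n} (row (first path))

  private
    y = vertex path
    i = row (first path)
    t : Fin (2 + m) × Fin n
    t = spare , proj₂ (first path)

    kept⇒≢i : ∀ w → T (kept w) → row w ≢ i
    kept⇒≢i w Kw = subst (_≢ i) (proj₂ (kept-row w Kw)) (keep≢i _)

    kept⇒≢spare : ∀ w → T (kept w) → row w ≢ spare
    kept⇒≢spare w Kw = subst (_≢ spare) (proj₂ (kept-row w Kw)) (keep≢spare _)

    avoids : Avoids kept path
    avoids {w = w} j≤l Kw e = kept⇒≢i w Kw (trans (cong row e) (in-row j≤l))

    isolated : InteriorIsolated kept path
    isolated {j} {w} 0<j j<l Kw =
      trans (flip-rows C F Fs (y j) w λ e → kept⇒≢i w Kw (trans (sym e) (in-row (<⇒≤ j<l))))
            (cong (λ p → inF F p (colPart C w)) (interior 0<j j<l))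

    pendant-only : ∀ {j} → 0 < j → j ≤ length → adj G t (y j) ≡ false
    pendant-only {j} 0<j j≤l =
      trans (flip-rows C F Fs t (y j) λ e → spare≢i (trans e (in-row j≤l))) (by-cases (j ℕ.≟ length))
      where
      by-cases : Dec (j ≡ length) → inF F (colPart C (first path)) (colPart C (y j)) ≡ false
      by-cases (yes refl) = trans (cong₂ (inF F) starts ends) FXX'
      by-cases (no j≢l) = cong₂ (inF F) starts (interior 0<j (≤∧≢⇒< j≤l j≢l))

    pendantTwin : PendantTwin kept path t
    pendantTwin = record
      { off-K = λ {w} Kw e → kept⇒≢spare w Kw (cong row e)
      ; off-path = λ j≤l e → spare≢i (trans (cong row e) (in-row j≤l))
      ; pendant = trans (flip-rows C F Fs t (y 0) spare≢i) (trans (cong₂ (inF F) starts starts) FXX)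
      ; pendant-only = pendant-only
      ; twin = λ {w} Kw → trans (flip-rows C F Fs t w λ e → kept⇒≢spare w Kw (sym e))
                                (sym (flip-rows C F Fs (y 0) w λ e → kept⇒≢i w Kw (sym e))) }

    end-adj : ∀ {v Y} → colPart C v ≡ just Y → row v ≡ i
            → ∀ a b → adj G v (keep a , b) ≡ inF F (just Y) (part C b)
    end-adj {v} part-v row-v a b =
      trans (flip-rows C F Fs v (keep a , b) λ e → keep≢i a (sym (trans (sym row-v) e)))
            (cong (λ p → inF F p (part C b)) part-v)

    open Contraction (contract positive path avoids isolated pendantTwin)

    kept-adj : ∀ a b a' b' → adjacent adjacency (keep a , b) (keep a' , b')
             ≡ adj (flipMP m n k C F' Fs') (a , b) (a' , b')
    kept-adj a b a' b' = begin
      adjacent adjacency (keep a , b) (keep a' , b')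
        ≡⟨ on-K (kept-keep a {b}) (kept-keep a' {b'}) ⟩
      pivotAdj G (first path) (last path) (keep a , b) (keep a' , b')
        ≡⟨ cong₂ _xor_ (flipMP-rows C F Fs keep keep-injective a b a' b')
             (cong₂ _xor_ (cong₂ _∧_ (first-adj a b) (last-adj a' b'))
                          (cong₂ _∧_ (last-adj a b) (first-adj a' b'))) ⟩
      adj (flipMP m n k C F Fs) (a , b) (a' , b')
        xor cross (inF F (just X) ∘ colPart C) (inF F (just X') ∘ colPart C) (a , b) (a' , b')
        ≡⟨ sym (flipMP-crossFlip C F Fs X X' Fs' (a , b) (a' , b')) ⟩
      adj (flipMP m n k C F' Fs') (a , b) (a' , b') ∎
      where
      open ≡-Reasoning
      first-adj = end-adj starts refl
      last-adj = end-adj ends (in-row ≤-refl)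

    extend : (Σ Graph λ H → PivotMinor (G ⟦ adjacency ⟧) H × H ≅ induced (G ⟦ adjacency ⟧) kept)
           → Σ Graph λ H → PivotMinor G H × H ≅ flipMP m n k C F' Fs'
    extend (H , H-minor , H≅) =
      H , pivotMinor-trans minor H-minor , ≅-trans H≅ (rows-≅ adjacency (adjacencyOf (flipMP m n k C _ _)) kept-adj)

  collapsed : Σ Graph λ H → PivotMinor G H × H ≅ flipMP m n k C F' Fs'
  collapsed = extend (induced-pivotMinor ((2 + m) * n) (G ⟦ adjacency ⟧) kept (just ∘ remQuot n)
    λ (a , b) _ → combine a b , cong just (remQuot-combine a b))

lemma3p8 : (m n k : ℕ) → 1 ≤ m → 1 ≤ n → 2 ≤ k
    → (C : Coarsening n k) (F : Fin k → Fin k → Bool) (Fs : ∀ a b → F a b ≡ F b a)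
    → (X X' : Fin k) → X ≢ X'
    → F X X ≡ true → F X' X' ≡ true → F X X' ≡ false
    → ZPath (flipMP (2 + m) n k C F Fs) (inUnion C) (inMember C X) (inMember C X')
    → Σ Graph (λ H → PivotMinor (flipMP (2 + m) n k C F Fs) H × KFlippedIso (k ∸ 1) m n H)
lemma3p8 m n 1 _ _ (s≤s ()) _ _ _ _ _ _ _ _ _ _
lemma3p8 m n (suc (suc k)) _ _ _ C F Fs X X' X≢X' FXX FX'X' FXX' π =
  let H , minor , H≅ = Collapse.collapsed C F Fs X≢X' FXX FXX' π
  in  H , minor , suc k , ≤-refl , mergeCoarsening C , mergedF , mergedF-sym ,
      ≅-trans H≅ (flipMP-≅ C F' Fs' (mergeCoarsening C) mergedF mergedF-sym
                   λ j j' → inF-merge (part C j) (part C j'))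
  where
  F' = crossFlip F X X'
  Fs' = crossFlip-sym F X X' Fs
  open Merge F' Fs' X≢X' (crossFlip-twins F X X' Fs FXX FX'X' FXX')
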